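{- Let $G=(V,E)$ and $G'=(V,E')$ be distinct graphs on the same vertex set $V$, each with $m\ge 1$ edges. Then $|q^*(G)-q^*(G')|<\frac{|E\triangle E'|}{m}$.
   Context: For a graph $G$ with $m\ge 1$ edges and a vertex partition $\mathcal A$, $q_{\mathcal A}(G)=\frac1m\sum_{A\in\mathcal A}e(A)-\frac{1}{4m^2}\sum_{A\in\mathcal A}\mathrm{vol}(A)^2$ ($e(A)$: number of edges within $A$; $\mathrm{vol}(A)$: sum of degrees in $A$); $q^*(G)=\max_{\mathcal A}q_{\mathcal A}(G)$ over all vertex partitions. -}

module Defs where

open import Data.Bool using (Bool; true; false; _∧_; if_then_else_; not)
open import Data.Nat as ℕ using (ℕ; zero; suc; _<ᵇ_)
open import Data.Fin as Fin using (Fin; zero; suc; toℕ)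
open import Data.List using (List; []; _∷_; map; concatMap; allFin)
open import Data.Nat.ListAction using (sum)
open import Data.Integer using (+_)
open import Data.Rational using (ℚ; 0ℚ; _/_; _-_; _⊔_)
open import Relation.Nullary.Decidable using (⌊_⌋)
open import Relation.Binary.PropositionalEquality using (_≡_)

record Graph (n : ℕ) : Set where
  field
    adj    : Fin n → Fin n → Bool
    sym    : ∀ i j → adj i j ≡ adj j i
    irrefl : ∀ i → adj i i ≡ false
open Graph public

Σ[_] : {n : ℕ} → (Fin n → ℕ) → ℕ
Σ[_] {n} f = sum (map f (allFin n))

indicator : Bool → ℕ
indicator true  = 1
indicator false = 0

pairCount : {n : ℕ} → (Fin n → Fin n → Bool) → ℕ
pairCount P = Σ[ (λ i → Σ[ (λ j → indicator ((toℕ i <ᵇ toℕ j) ∧ P i j)) ] ) ]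

edgeCount : {n : ℕ} → Graph n → ℕ
edgeCount G = pairCount (adj G)

symDiffCount : {n : ℕ} → Graph n → Graph n → ℕ
symDiffCount G G' = pairCount (λ i j → not ⌊ adj G i j Data.Bool.≟ adj G' i j ⌋)
  where import Data.Bool

degree : {n : ℕ} → Graph n → Fin n → ℕ
degree G i = Σ[ (λ j → indicator (adj G i j)) ]

-- A vertex partition of Fin n is represented by a labelling Fin n → Fin n
-- (part A_c = vertices labelled c); every partition of an n-set has at most
-- n parts, so every partition arises this way. Empty parts contribute 0.
Labelling : ℕ → Set
Labelling n = Fin n → Fin n

sameLabel : {n : ℕ} → Labelling n → Fin n → Fin n → Bool
sameLabel ℓ i j = ⌊ ℓ i Fin.≟ ℓ j ⌋

intraEdges : {n : ℕ} → Graph n → Labelling n → ℕ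
intraEdges G ℓ = pairCount (λ i j → adj G i j ∧ sameLabel ℓ i j)

vol : {n : ℕ} → Graph n → Labelling n → Fin n → ℕ
vol G ℓ c = Σ[ (λ i → indicator ⌊ ℓ i Fin.≟ c ⌋ ℕ.* degree G i) ]

-- natural-number fraction a / b as a rational (b = 0 ↦ 0, never used when m ≥ 1)
_/ℕ_ : ℕ → ℕ → ℚ
a /ℕ zero  = 0ℚ
a /ℕ suc b = (+ a) / suc b

modularity : {n : ℕ} → Graph n → Labelling n → ℚ
modularity G ℓ =
  (intraEdges G ℓ /ℕ m) - (Σ[ (λ c → vol G ℓ c ℕ.* vol G ℓ c) ] /ℕ (4 ℕ.* m ℕ.* m))
  where m = edgeCount G

allFuns : (n k : ℕ) → List (Fin n → Fin k)
allFuns zero    k = (λ ()) ∷ []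
allFuns (suc n) k =
  concatMap (λ c → map (λ f → λ { zero → c ; (suc i) → f i }) (allFuns n k)) (allFin k)

-- maximum of a list (the lists used below are always nonempty)
maxList : List ℚ → ℚ
maxList []           = 0ℚ
maxList (x ∷ [])     = x
maxList (x ∷ y ∷ ys) = x ⊔ maxList (y ∷ ys)

maxModularity : {n : ℕ} → Graph n → ℚ
maxModularity {n} G = maxList (map (modularity G) (allFuns n n))

module Submission where

-- Fix a partition ℓ and suppose m = m' ≥ 1.  Multiplying q_ℓ by 4m² gives the
-- integer numerator 4m·Σ e(A) − Σ vol(A)².  Writing T(A) = vol_G(A) + vol_G'(A), the
-- difference of the numerators of G and G' is a sum over vertex pairs {i, j} of
-- ([ij ∈ E] − [ij ∈ E'])·φ_ij with φ_ij = 4m·[ℓ i = ℓ j] − T(ℓ i) − T(ℓ j).  Since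
-- Σ_A T(A) = 4m, a pair of E ∖ E' contributes at most 4m − 4 and a pair of E' ∖ E at most
-- 4m, so the difference is at most 4m·|E △ E'| − 4·|E ∖ E'|; and |E ∖ E'| = |E' ∖ E| ≥ 1
-- for distinct graphs with equally many edges.  Dividing by 4m² gives
-- q_ℓ(G) < q_ℓ(G') + |E △ E'|/m for every ℓ, symmetrically in G and G', and the bound
-- passes to the maxima q*.

open import Defs hiding (sym)
open Graph using () renaming (sym to adj-sym)
open import Data.Nat using (ℕ)
open import Data.Fin using (Fin)

module IntegerSums where

  open import Data.Bool using (true; false; _∧_)
  open import Data.Nat using (zero; suc; z≤n)
  import Data.Nat as ℕ
  open import Data.Nat.ListAction using () renaming (sum to sumℕ)
  open import Data.Fin using (zero; suc; _≟_)
  open import Data.List.Properties using (map-tabulate)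
  open import Data.Integer using (ℤ; +_; 0ℤ; 1ℤ; -1ℤ; _+_; _-_; _*_; -_; _≤_; +≤+)
  open import Data.Integer.Properties
    using (+-*-semiring; pos-+; pos-*; -1*i≡-i; ≤-refl; ≤-reflexive; +-mono-≤; *-zeroˡ; *-identityˡ; +-identityˡ; +-identityʳ)
  open import Relation.Binary.PropositionalEquality
  open import Relation.Nullary using (yes; no)
  open import Relation.Nullary.Decidable using (⌊_⌋)
  open import Data.Empty using (⊥-elim)
  open import Function using (_∘_; id)

  open import Algebra.Properties.Semiring.Sum +-*-semiring public
    using (sum-syntax; sum-cong-≗; ∑-distrib-+; ∑-comm; *-distribˡ-sum; *-distribʳ-sum; sum-replicate-zero)

  Σ-suc : ∀ {n} (f : Fin (suc n) → ℕ) → Σ[ f ] ≡ f zero ℕ.+ Σ[ f ∘ suc ]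
  Σ-suc f = cong (λ xs → f zero ℕ.+ sumℕ xs)
    (trans (map-tabulate suc f) (sym (map-tabulate id (f ∘ suc))))

  Σ-toℤ : ∀ {n} (f : Fin n → ℕ) → + Σ[ f ] ≡ ∑[ i < n ] (+ f i)
  Σ-toℤ {zero}  f = refl
  Σ-toℤ {suc n} f = begin
      + Σ[ f ]                           ≡⟨ cong +_ (Σ-suc f) ⟩
      + (f zero ℕ.+ Σ[ f ∘ suc ])        ≡⟨ pos-+ (f zero) _ ⟩
      + f zero + + Σ[ f ∘ suc ]          ≡⟨ cong (λ s → + f zero + s) (Σ-toℤ (f ∘ suc)) ⟩
      ∑[ i < suc n ] (+ f i)             ∎
    where open ≡-Reasoning

  ∑-distrib-- : ∀ {n} (f g : Fin n → ℤ) → ∑[ i < n ] (f i - g i) ≡ ∑[ i < n ] f i - ∑[ i < n ] g i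
  ∑-distrib-- {n} f g = begin
      ∑[ i < n ] (f i - g i)                  ≡⟨ ∑-distrib-+ f (λ i → - g i) ⟩
      ∑[ i < n ] f i + ∑[ i < n ] (- g i)     ≡⟨ cong (λ s → ∑[ i < n ] f i + s) ∑-neg ⟩
      ∑[ i < n ] f i - ∑[ i < n ] g i         ∎
    where
    open ≡-Reasoning
    ∑-neg : ∑[ i < n ] (- g i) ≡ - ∑[ i < n ] g i
    ∑-neg = begin
      ∑[ i < n ] (- g i)       ≡⟨ sum-cong-≗ (λ i → sym (-1*i≡-i (g i))) ⟩
      ∑[ i < n ] (-1ℤ * g i)   ≡⟨ sym (*-distribˡ-sum -1ℤ g) ⟩
      -1ℤ * ∑[ i < n ] g i     ≡⟨ -1*i≡-i _ ⟩
      - ∑[ i < n ] g i         ∎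

  ∑-mono-≤ : ∀ {n} {f g : Fin n → ℤ} → (∀ i → f i ≤ g i) → ∑[ i < n ] f i ≤ ∑[ i < n ] g i
  ∑-mono-≤ {zero}  f≤g = ≤-refl
  ∑-mono-≤ {suc n} f≤g = +-mono-≤ (f≤g zero) (∑-mono-≤ (f≤g ∘ suc))

  ∑-nonNeg : ∀ {n} {f : Fin n → ℤ} → (∀ i → 0ℤ ≤ f i) → 0ℤ ≤ ∑[ i < n ] f i
  ∑-nonNeg {n} {f} 0≤f = subst (λ z → z ≤ ∑[ i < n ] f i) (sum-replicate-zero n) (∑-mono-≤ 0≤f)

  δ : ∀ {n} → Fin n → Fin n → ℤ
  δ x c = + indicator ⌊ x ≟ c ⌋

  δ-suc : ∀ {n} (x c : Fin n) → δ (suc x) (suc c) ≡ δ x c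
  δ-suc x c with x ≟ c
  ... | yes _ = refl
  ... | no  _ = refl

  ∑-δ : ∀ {n} (x : Fin n) (f : Fin n → ℤ) → ∑[ c < n ] (δ x c * f c) ≡ f x
  ∑-δ {suc n} zero f = begin
      1ℤ * f zero + ∑[ c < n ] (0ℤ * f (suc c))
        ≡⟨ cong₂ _+_ (*-identityˡ (f zero)) (sum-cong-≗ {n} (λ c → *-zeroˡ (f (suc c)))) ⟩
      f zero + ∑[ c < n ] 0ℤ                     ≡⟨ cong (_+_ (f zero)) (sum-replicate-zero n) ⟩
      f zero + 0ℤ                                ≡⟨ +-identityʳ _ ⟩
      f zero                                     ∎
    where open ≡-Reasoning
  ∑-δ {suc n} (suc x) f = begin
      0ℤ * f zero + ∑[ c < n ] (δ (suc x) (suc c) * f (suc c))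
        ≡⟨ cong₂ _+_ (*-zeroˡ (f zero)) (sum-cong-≗ (λ c → cong (_* f (suc c)) (δ-suc x c))) ⟩
      0ℤ + ∑[ c < n ] (δ x c * f (suc c))            ≡⟨ +-identityˡ _ ⟩
      ∑[ c < n ] (δ x c * f (suc c))                 ≡⟨ ∑-δ x (f ∘ suc) ⟩
      f (suc x)                                      ∎
    where open ≡-Reasoning

  δ-self : ∀ {n} (x : Fin n) → δ x x ≡ 1ℤ
  δ-self x with x ≟ x
  ... | yes _   = refl
  ... | no  x≢x = ⊥-elim (x≢x refl)

  indicator-∧ : ∀ a b → + indicator (a ∧ b) ≡ + indicator a * + indicator b
  indicator-∧ true  b = sym (*-identityˡ (+ indicator b))
  indicator-∧ false b = sym (*-zeroˡ (+ indicator b))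

  +*+-nonNeg : ∀ a b → 0ℤ ≤ + a * + b
  +*+-nonNeg a b = subst (_≤_ 0ℤ) (pos-* a b) (+≤+ z≤n)

  δ-scale≤ : ∀ {n} (x c : Fin n) {v : ℤ} → 0ℤ ≤ v → δ x c * v ≤ v
  δ-scale≤ x c {v} 0≤v with x ≟ c
  ... | yes _ = ≤-reflexive (*-identityˡ v)
  ... | no  _ = subst (λ z → z ≤ v) (sym (*-zeroˡ v)) 0≤v

  δ-pair-scale≤ : ∀ {n} {x y : Fin n} → x ≢ y → ∀ c {v : ℤ} → 0ℤ ≤ v → δ x c * v + δ y c * v ≤ v
  δ-pair-scale≤ {x = x} {y} x≢y c {v} 0≤v with x ≟ c | y ≟ c
  ... | yes refl | yes refl = ⊥-elim (x≢y refl)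
  ... | yes _    | no  _    = ≤-reflexive (trans (cong₂ _+_ (*-identityˡ v) (*-zeroˡ v)) (+-identityʳ v))
  ... | no  _    | yes _    = ≤-reflexive (trans (cong₂ _+_ (*-zeroˡ v) (*-identityˡ v)) (+-identityˡ v))
  ... | no  _    | no  _    = subst (λ z → z ≤ v) (sym (cong₂ _+_ (*-zeroˡ v) (*-zeroˡ v))) 0≤v

  term≤∑ : ∀ {n} {f : Fin n → ℤ} → (∀ c → 0ℤ ≤ f c) → ∀ x → f x ≤ ∑[ c < n ] f c
  term≤∑ {n} {f} 0≤f x =
    subst (λ z → z ≤ ∑[ c < n ] f c) (∑-δ x f) (∑-mono-≤ (λ c → δ-scale≤ x c (0≤f c)))

  two-terms≤∑ : ∀ {n} {f : Fin n → ℤ} → (∀ c → 0ℤ ≤ f c) → ∀ {x y} → x ≢ y → f x + f y ≤ ∑[ c < n ] f c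
  two-terms≤∑ {n} {f} 0≤f {x} {y} x≢y = subst (λ z → z ≤ ∑[ c < n ] f c) picks
    (∑-mono-≤ (λ c → δ-pair-scale≤ x≢y c (0≤f c)))
    where
    picks : ∑[ c < n ] (δ x c * f c + δ y c * f c) ≡ f x + f y
    picks = trans (∑-distrib-+ (λ c → δ x c * f c) (λ c → δ y c * f c)) (cong₂ _+_ (∑-δ x f) (∑-δ y f))

module PairSums where

  open IntegerSums
  open import Data.Bool using (Bool; true; false; _∧_)
  open import Data.Nat using (_<ᵇ_; <-cmp)
  import Data.Nat as ℕ
  open import Data.Nat.Properties using (<ᵇ-reflects-<)
  open import Data.Fin using (toℕ)
  open import Data.Fin.Properties using (toℕ-injective)
  open import Data.Integer using (ℤ; +_; 0ℤ; 1ℤ; -1ℤ; _+_; _-_; _*_; _≤_)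
  open import Data.Integer.Properties
    using (pos-+; +-injective; -1*i≡-i; *-zeroˡ; *-zeroʳ; *-identityˡ; +-identityˡ; +-identityʳ; *-distribˡ-+;
           *-monoˡ-≤-nonNeg; module ≤-Reasoning)
  open import Data.Integer.Solver using (module +-*-Solver)
  open import Relation.Binary.PropositionalEquality
  open import Relation.Binary.Definitions using (tri<; tri≈; tri>)
  open import Relation.Nullary using (¬_)
  open import Relation.Nullary.Reflects using (ofʸ; ofⁿ)
  open import Data.Empty using (⊥-elim)

  -- below i j is the indicator of toℕ i < toℕ j; weighting a double sum by it
  -- keeps each unordered pair of distinct indices exactly once.
  below : ∀ {n} → Fin n → Fin n → ℤ
  below i j = + indicator (toℕ i <ᵇ toℕ j)

  below-< : ∀ {n} {i j : Fin n} → toℕ i ℕ.< toℕ j → below i j ≡ 1ℤ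
  below-< {i = i} {j} i<j with toℕ i <ᵇ toℕ j | <ᵇ-reflects-< (toℕ i) (toℕ j)
  ... | true  | _       = refl
  ... | false | ofⁿ i≮j = ⊥-elim (i≮j i<j)

  below-≮ : ∀ {n} {i j : Fin n} → ¬ toℕ i ℕ.< toℕ j → below i j ≡ 0ℤ
  below-≮ {i = i} {j} i≮j with toℕ i <ᵇ toℕ j | <ᵇ-reflects-< (toℕ i) (toℕ j)
  ... | true  | ofʸ i<j = ⊥-elim (i≮j i<j)
  ... | false | _       = refl

  pairSum : ∀ {n} → (Fin n → Fin n → ℤ) → ℤ
  pairSum {n} h = ∑[ i < n ] ∑[ j < n ] (below i j * h i j)

  module _ {n : ℕ} where

    pairSum-cong : {h g : Fin n → Fin n → ℤ} → (∀ i j → h i j ≡ g i j) → pairSum h ≡ pairSum g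
    pairSum-cong h≡g = sum-cong-≗ (λ i → sum-cong-≗ (λ j → cong (below i j *_) (h≡g i j)))

    pairSum-+ : (h g : Fin n → Fin n → ℤ) → pairSum (λ i j → h i j + g i j) ≡ pairSum h + pairSum g
    pairSum-+ h g = begin
        ∑[ i < n ] ∑[ j < n ] (below i j * (h i j + g i j))
      ≡⟨ sum-cong-≗ (λ i → sum-cong-≗ (λ j → *-distribˡ-+ (below i j) (h i j) (g i j))) ⟩
        ∑[ i < n ] ∑[ j < n ] (below i j * h i j + below i j * g i j)
      ≡⟨ sum-cong-≗ (λ i → ∑-distrib-+ (λ j → below i j * h i j) (λ j → below i j * g i j)) ⟩
        ∑[ i < n ] (∑[ j < n ] (below i j * h i j) + ∑[ j < n ] (below i j * g i j))
      ≡⟨ ∑-distrib-+ (λ i → ∑[ j < n ] (below i j * h i j)) (λ i → ∑[ j < n ] (below i j * g i j)) ⟩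
        pairSum h + pairSum g
      ∎
      where open ≡-Reasoning

    pairSum-scale : (c : ℤ) (h : Fin n → Fin n → ℤ) → pairSum (λ i j → c * h i j) ≡ c * pairSum h
    pairSum-scale c h = begin
        ∑[ i < n ] ∑[ j < n ] (below i j * (c * h i j))
      ≡⟨ sum-cong-≗ (λ i → sum-cong-≗ (λ j → swap-scalar c (below i j) (h i j))) ⟩
        ∑[ i < n ] ∑[ j < n ] (c * (below i j * h i j))
      ≡⟨ sum-cong-≗ (λ i → sym (*-distribˡ-sum c (λ j → below i j * h i j))) ⟩
        ∑[ i < n ] (c * ∑[ j < n ] (below i j * h i j))
      ≡⟨ sym (*-distribˡ-sum c (λ i → ∑[ j < n ] (below i j * h i j))) ⟩
        c * pairSum h
      ∎
      where
      open ≡-Reasoning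
      open +-*-Solver
      swap-scalar : ∀ c x y → x * (c * y) ≡ c * (x * y)
      swap-scalar = solve 3 (λ c x y → x :* (c :* y) := c :* (x :* y)) refl

    pairSum-- : (h g : Fin n → Fin n → ℤ) → pairSum (λ i j → h i j - g i j) ≡ pairSum h - pairSum g
    pairSum-- h g = begin
        pairSum (λ i j → h i j - g i j)
      ≡⟨ pairSum-cong (λ i j → cong (_+_ (h i j)) (sym (-1*i≡-i (g i j)))) ⟩
        pairSum (λ i j → h i j + -1ℤ * g i j)
      ≡⟨ pairSum-+ h (λ i j → -1ℤ * g i j) ⟩
        pairSum h + pairSum (λ i j → -1ℤ * g i j)
      ≡⟨ cong (_+_ (pairSum h)) (trans (pairSum-scale -1ℤ g) (-1*i≡-i (pairSum g))) ⟩
        pairSum h - pairSum g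
      ∎
      where open ≡-Reasoning

    pairSum-mono : {h g : Fin n → Fin n → ℤ} → (∀ i j → h i j ≤ g i j) → pairSum h ≤ pairSum g
    pairSum-mono h≤g = ∑-mono-≤ (λ i → ∑-mono-≤ (λ j → *-monoˡ-≤-nonNeg (below i j) (h≤g i j)))

    pairSum-term : {h : Fin n → Fin n → ℤ} → (∀ i j → 0ℤ ≤ h i j) →
                   ∀ {i j} → toℕ i ℕ.< toℕ j → h i j ≤ pairSum h
    pairSum-term {h} 0≤h {i} {j} i<j = begin
        h i j                                 ≡⟨ sym (trans (cong (_* h i j) (below-< i<j)) (*-identityˡ (h i j))) ⟩
        below i j * h i j                     ≤⟨ term≤∑ (0≤term i) j ⟩
        ∑[ j′ < n ] (below i j′ * h i j′)     ≤⟨ term≤∑ (λ i′ → ∑-nonNeg (0≤term i′)) i ⟩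
        pairSum h                             ∎
      where
      open ≤-Reasoning
      0≤term : ∀ i j → 0ℤ ≤ below i j * h i j
      0≤term i j = subst (λ z → z ≤ below i j * h i j) (*-zeroʳ (below i j)) (*-monoˡ-≤-nonNeg (below i j) (0≤h i j))

    pairCount-pairSum : (P : Fin n → Fin n → Bool) → + pairCount P ≡ pairSum (λ i j → + indicator (P i j))
    pairCount-pairSum P =
      trans (Σ-toℤ (λ i → Σ[ counted i ])) (sum-cong-≗ (λ i →
        trans (Σ-toℤ (counted i)) (sum-cong-≗ (λ j → indicator-∧ (toℕ i <ᵇ toℕ j) (P i j)))))
      where
      counted : Fin n → Fin n → ℕ
      counted i j = indicator ((toℕ i <ᵇ toℕ j) ∧ P i j)

    pairCount-cong : {P Q : Fin n → Fin n → Bool} → (∀ i j → P i j ≡ Q i j) → pairCount P ≡ pairCount Q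
    pairCount-cong {P} {Q} P≡Q = +-injective (trans (pairCount-pairSum P)
      (trans (pairSum-cong (λ i j → cong (λ b → + indicator b) (P≡Q i j))) (sym (pairCount-pairSum Q))))

    pairCount-split : {P Q R : Fin n → Fin n → Bool} →
      (∀ i j → indicator (P i j) ≡ indicator (Q i j) ℕ.+ indicator (R i j)) → pairCount P ≡ pairCount Q ℕ.+ pairCount R
    pairCount-split {P} {Q} {R} P≡Q+R = +-injective (begin
        + pairCount P                                                   ≡⟨ pairCount-pairSum P ⟩
        pairSum (λ i j → + indicator (P i j))
          ≡⟨ pairSum-cong (λ i j → trans (cong +_ (P≡Q+R i j)) (pos-+ (indicator (Q i j)) (indicator (R i j)))) ⟩
        pairSum (λ i j → + indicator (Q i j) + + indicator (R i j))     ≡⟨ pairSum-+ _ _ ⟩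
        pairSum (λ i j → + indicator (Q i j)) + pairSum (λ i j → + indicator (R i j))
          ≡⟨ sym (cong₂ _+_ (pairCount-pairSum Q) (pairCount-pairSum R)) ⟩
        + pairCount Q + + pairCount R                                   ≡⟨ sym (pos-+ (pairCount Q) (pairCount R)) ⟩
        + (pairCount Q ℕ.+ pairCount R)                                 ∎)
      where open ≡-Reasoning

    below-split : (h : Fin n → Fin n → ℤ) → (∀ i → h i i ≡ 0ℤ) →
                  ∀ i j → h i j ≡ below i j * h i j + below j i * h i j
    below-split h h-diag i j with <-cmp (toℕ i) (toℕ j)
    ... | tri< i<j _ j≮i = sym (begin
          below i j * h i j + below j i * h i j   ≡⟨ cong₂ (λ a b → a * h i j + b * h i j) (below-< i<j) (below-≮ j≮i) ⟩
          1ℤ * h i j + 0ℤ * h i j                 ≡⟨ cong₂ _+_ (*-identityˡ (h i j)) (*-zeroˡ (h i j)) ⟩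
          h i j + 0ℤ                              ≡⟨ +-identityʳ (h i j) ⟩
          h i j                                   ∎)
      where open ≡-Reasoning
    ... | tri> i≮j _ j<i = sym (begin
          below i j * h i j + below j i * h i j   ≡⟨ cong₂ (λ a b → a * h i j + b * h i j) (below-≮ i≮j) (below-< j<i) ⟩
          0ℤ * h i j + 1ℤ * h i j                 ≡⟨ cong₂ _+_ (*-zeroˡ (h i j)) (*-identityˡ (h i j)) ⟩
          0ℤ + h i j                              ≡⟨ +-identityˡ (h i j) ⟩
          h i j                                   ∎)
      where open ≡-Reasoning
    ... | tri≈ _ i≡j _ with toℕ-injective i≡j
    ...   | refl = begin
          h i i                                   ≡⟨ h-diag i ⟩
          0ℤ                                      ≡⟨ sym (cong₂ _+_ (*-zeroʳ (below i i)) (*-zeroʳ (below i i))) ⟩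
          below i i * 0ℤ + below i i * 0ℤ         ≡⟨ sym (cong (λ z → below i i * z + below i i * z) (h-diag i)) ⟩
          below i i * h i i + below i i * h i i   ∎
      where open ≡-Reasoning

    ∑∑-fold : (h : Fin n → Fin n → ℤ) → (∀ i → h i i ≡ 0ℤ) →
              ∑[ i < n ] ∑[ j < n ] h i j ≡ pairSum (λ i j → h i j + h j i)
    ∑∑-fold h h-diag = begin
        ∑[ i < n ] ∑[ j < n ] h i j
      ≡⟨ sum-cong-≗ (λ i → sum-cong-≗ (below-split h h-diag i)) ⟩
        ∑[ i < n ] ∑[ j < n ] (below i j * h i j + below j i * h i j)
      ≡⟨ sum-cong-≗ (λ i → ∑-distrib-+ (λ j → below i j * h i j) (λ j → below j i * h i j)) ⟩
        ∑[ i < n ] (∑[ j < n ] (below i j * h i j) + ∑[ j < n ] (below j i * h i j))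
      ≡⟨ ∑-distrib-+ (λ i → ∑[ j < n ] (below i j * h i j)) (λ i → ∑[ j < n ] (below j i * h i j)) ⟩
        pairSum h + ∑[ i < n ] ∑[ j < n ] (below j i * h i j)
      ≡⟨ cong (_+_ (pairSum h)) (∑-comm (λ i j → below j i * h i j)) ⟩
        pairSum h + pairSum (λ i j → h j i)
      ≡⟨ sym (pairSum-+ h (λ i j → h j i)) ⟩
        pairSum (λ i j → h i j + h j i)
      ∎
      where open ≡-Reasoning

module GraphSums {n : ℕ} (H : Graph n) where

  open IntegerSums
  open PairSums
  open import Data.Bool using (true; _∧_)
  import Data.Nat as ℕ
  open import Data.Fin using (_≟_)
  open import Data.Integer using (ℤ; +_; 0ℤ; 1ℤ; _+_; _-_; _*_; _≤_; +≤+)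
  open import Data.Integer.Properties
    using (pos-*; *-zeroˡ; *-identityˡ; *-identityʳ; *-distribˡ-+; *-assoc; *-comm; +-mono-≤; module ≤-Reasoning)
  open import Data.Integer.Solver using (module +-*-Solver)
  open import Relation.Binary.PropositionalEquality
  open import Relation.Nullary.Decidable using (⌊_⌋)
  open import Relation.Nullary.Negation using (contradiction)
  open import Function using (_∘_)

  A : Fin n → Fin n → ℤ
  A i j = + indicator (adj H i j)

  deg : Fin n → ℤ
  deg i = + degree H i

  A-sym : ∀ i j → A i j ≡ A j i
  A-sym i j = cong (λ b → + indicator b) (adj-sym H i j)

  A-diag : ∀ i → A i i ≡ 0ℤ
  A-diag i = cong (λ b → + indicator b) (irrefl H i)

  deg-∑ : ∀ i → deg i ≡ ∑[ j < n ] A i j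
  deg-∑ i = Σ-toℤ (λ j → indicator (adj H i j))

  edges-pairSum : + edgeCount H ≡ pairSum A
  edges-pairSum = pairCount-pairSum (adj H)

  ∑-deg-weighted : (w : Fin n → ℤ) → ∑[ i < n ] (deg i * w i) ≡ pairSum (λ i j → A i j * (w i + w j))
  ∑-deg-weighted w = begin
      ∑[ i < n ] (deg i * w i)
    ≡⟨ sum-cong-≗ (λ i → trans (cong (_* w i) (deg-∑ i)) (*-distribʳ-sum (w i) (A i))) ⟩
      ∑[ i < n ] ∑[ j < n ] (A i j * w i)
    ≡⟨ ∑∑-fold (λ i j → A i j * w i) (λ i → trans (cong (_* w i) (A-diag i)) (*-zeroˡ (w i))) ⟩
      pairSum (λ i j → A i j * w i + A j i * w j)
    ≡⟨ pairSum-cong (λ i j → trans (cong (λ a → A i j * w i + a * w j) (A-sym j i)) (sym (*-distribˡ-+ (A i j) (w i) (w j)))) ⟩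
      pairSum (λ i j → A i j * (w i + w j))
    ∎
    where open ≡-Reasoning

  handshake : ∑[ i < n ] deg i ≡ + 2 * + edgeCount H
  handshake = begin
      ∑[ i < n ] deg i
    ≡⟨ sum-cong-≗ (λ i → sym (*-identityʳ (deg i))) ⟩
      ∑[ i < n ] (deg i * 1ℤ)
    ≡⟨ ∑-deg-weighted (λ _ → 1ℤ) ⟩
      pairSum (λ i j → A i j * + 2)
    ≡⟨ pairSum-cong (λ i j → *-comm (A i j) (+ 2)) ⟩
      pairSum (λ i j → + 2 * A i j)
    ≡⟨ pairSum-scale (+ 2) A ⟩
      + 2 * pairSum A
    ≡⟨ cong (+ 2 *_) (sym edges-pairSum) ⟩
      + 2 * + edgeCount H
    ∎
    where open ≡-Reasoning

  deg-pos : ∀ {i j} → adj H i j ≡ true → 1ℤ ≤ deg i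
  deg-pos {i} {j} ij∈H = subst₂ _≤_ (cong (λ b → + indicator b) ij∈H) (sym (deg-∑ i))
    (term≤∑ (λ k → +≤+ ℕ.z≤n) j)

  module _ (ℓ : Labelling n) where

    V : Fin n → ℤ
    V c = + vol H ℓ c

    intra-pairSum : + intraEdges H ℓ ≡ pairSum (λ i j → A i j * δ (ℓ i) (ℓ j))
    intra-pairSum = trans (pairCount-pairSum (λ i j → adj H i j ∧ sameLabel ℓ i j))
      (pairSum-cong (λ i j → indicator-∧ (adj H i j) (sameLabel ℓ i j)))

    V-∑ : ∀ c → V c ≡ ∑[ i < n ] (δ (ℓ i) c * deg i)
    V-∑ c = trans (Σ-toℤ (λ i → indicator ⌊ ℓ i ≟ c ⌋ ℕ.* degree H i))
      (sum-cong-≗ (λ i → pos-* (indicator ⌊ ℓ i ≟ c ⌋) (degree H i)))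

    ∑-V-weighted : (t : Fin n → ℤ) → ∑[ c < n ] (V c * t c) ≡ ∑[ i < n ] (deg i * t (ℓ i))
    ∑-V-weighted t = begin
        ∑[ c < n ] (V c * t c)
      ≡⟨ sum-cong-≗ (λ c → trans (cong (_* t c) (V-∑ c)) (*-distribʳ-sum (t c) (λ i → δ (ℓ i) c * deg i))) ⟩
        ∑[ c < n ] ∑[ i < n ] (δ (ℓ i) c * deg i * t c)
      ≡⟨ ∑-comm (λ c i → δ (ℓ i) c * deg i * t c) ⟩
        ∑[ i < n ] ∑[ c < n ] (δ (ℓ i) c * deg i * t c)
      ≡⟨ sum-cong-≗ (λ i → trans (sum-cong-≗ (λ c → *-assoc (δ (ℓ i) c) (deg i) (t c))) (∑-δ (ℓ i) (λ c → deg i * t c))) ⟩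
        ∑[ i < n ] (deg i * t (ℓ i))
      ∎
      where open ≡-Reasoning

    V-edge : ∀ {i j} → adj H i j ≡ true → ℓ i ≡ ℓ j → + 2 ≤ V (ℓ i)
    V-edge {i} {j} ij∈H ℓi≡ℓj = begin
        + 2                 ≤⟨ +-mono-≤ (deg-pos ij∈H) (deg-pos (trans (adj-sym H j i) ij∈H)) ⟩
        deg i + deg j       ≡⟨ sym (cong₂ _+_ (in-part i refl) (in-part j (sym ℓi≡ℓj))) ⟩
        f i + f j           ≤⟨ two-terms≤∑ (λ k → +*+-nonNeg (indicator ⌊ ℓ k ≟ ℓ i ⌋) (degree H k)) i≢j ⟩
        ∑[ k < n ] f k      ≡⟨ sym (V-∑ (ℓ i)) ⟩
        V (ℓ i)             ∎
      where
      open ≤-Reasoning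
      f : Fin n → ℤ
      f k = δ (ℓ k) (ℓ i) * deg k
      in-part : ∀ k → ℓ k ≡ ℓ i → f k ≡ deg k
      in-part k ℓk≡ℓi =
        trans (cong (λ x → δ x (ℓ i) * deg k) ℓk≡ℓi) (trans (cong (_* deg k) (δ-self (ℓ i))) (*-identityˡ (deg k)))
      i≢j : i ≢ j
      i≢j refl = contradiction (trans (sym ij∈H) (irrefl H i)) λ ()

    ∑-V : ∑[ c < n ] V c ≡ + 2 * + edgeCount H
    ∑-V = begin
        ∑[ c < n ] V c                       ≡⟨ sum-cong-≗ (λ c → sym (*-identityʳ (V c))) ⟩
        ∑[ c < n ] (V c * 1ℤ)                ≡⟨ ∑-V-weighted (λ _ → 1ℤ) ⟩
        ∑[ i < n ] (deg i * 1ℤ)              ≡⟨ sum-cong-≗ (λ i → *-identityʳ (deg i)) ⟩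
        ∑[ i < n ] deg i                     ≡⟨ handshake ⟩
        + 2 * + edgeCount H                  ∎
      where open ≡-Reasoning

    ∑-V² : + Σ[ (λ c → vol H ℓ c ℕ.* vol H ℓ c) ] ≡ ∑[ c < n ] (V c * V c)
    ∑-V² = trans (Σ-toℤ (λ c → vol H ℓ c ℕ.* vol H ℓ c)) (sum-cong-≗ (λ c → pos-* (vol H ℓ c) (vol H ℓ c)))

    numerator-pairSum : (c : ℤ) (t : Fin n → ℤ) →
      c * + intraEdges H ℓ - ∑[ a < n ] (V a * t a) ≡ pairSum (λ i j → A i j * (c * δ (ℓ i) (ℓ j) - (t (ℓ i) + t (ℓ j))))
    numerator-pairSum c t = begin
        c * + intraEdges H ℓ - ∑[ a < n ] (V a * t a)
      ≡⟨ cong₂ (λ x y → c * x - y) intra-pairSum (trans (∑-V-weighted t) (∑-deg-weighted (t ∘ ℓ))) ⟩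
        c * pairSum (λ i j → A i j * δ (ℓ i) (ℓ j)) - pairSum (λ i j → A i j * (t (ℓ i) + t (ℓ j)))
      ≡⟨ cong (_- _) (sym (pairSum-scale c (λ i j → A i j * δ (ℓ i) (ℓ j)))) ⟩
        pairSum (λ i j → c * (A i j * δ (ℓ i) (ℓ j))) - pairSum (λ i j → A i j * (t (ℓ i) + t (ℓ j)))
      ≡⟨ sym (pairSum-- (λ i j → c * (A i j * δ (ℓ i) (ℓ j))) (λ i j → A i j * (t (ℓ i) + t (ℓ j)))) ⟩
        pairSum (λ i j → c * (A i j * δ (ℓ i) (ℓ j)) - A i j * (t (ℓ i) + t (ℓ j)))
      ≡⟨ pairSum-cong (λ i j → factor-edge c (A i j) (δ (ℓ i) (ℓ j)) (t (ℓ i) + t (ℓ j))) ⟩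
        pairSum (λ i j → A i j * (c * δ (ℓ i) (ℓ j) - (t (ℓ i) + t (ℓ j))))
      ∎
      where
      open ≡-Reasoning
      open +-*-Solver
      factor-edge : ∀ c a s u → c * (a * s) - a * u ≡ a * (c * s - u)
      factor-edge = solve 4 (λ c a s u → c :* (a :* s) :- a :* u := a :* (c :* s :- u)) refl

module EdgeDifference {n : ℕ} (G G' : Graph n) where

  open PairSums
  open import Data.Bool using (true; false; _∧_; not)
  import Data.Bool as Bool
  open import Data.Nat as ℕ using (z≤n; s≤s; <-cmp)
  open import Data.Nat.Properties using (+-cancelˡ-≡)
  open import Data.Fin using (toℕ)
  open import Data.Fin.Properties using (toℕ-injective; ¬∀⟶∃¬; all?)
  open import Data.Integer using (+_; +≤+)
  open import Data.Integer.Properties using (drop‿+≤+; module ≤-Reasoning)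
  open import Data.Product using (∃₂; _×_; _,_)
  open import Data.Empty using (⊥-elim)
  open import Relation.Binary.PropositionalEquality
  open import Relation.Binary.Definitions using (tri<; tri≈; tri>)
  open import Relation.Nullary using (¬_)
  open import Relation.Nullary.Decidable using (⌊_⌋)

  edgesOnlyIn : Graph n → Graph n → ℕ
  edgesOnlyIn H H' = pairCount (λ i j → adj H i j ∧ not (adj H' i j))

  edges-split : edgeCount G ≡ pairCount (λ i j → adj G i j ∧ adj G' i j) ℕ.+ edgesOnlyIn G G'
  edges-split = pairCount-split (λ i j → split (adj G i j) (adj G' i j))
    where
    split : ∀ a b → indicator a ≡ indicator (a ∧ b) ℕ.+ indicator (a ∧ not b)
    split true  true  = refl
    split true  false = refl
    split false _     = refl

  edges-split' : edgeCount G' ≡ pairCount (λ i j → adj G i j ∧ adj G' i j) ℕ.+ edgesOnlyIn G' G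
  edges-split' = pairCount-split (λ i j → split (adj G i j) (adj G' i j))
    where
    split : ∀ a b → indicator b ≡ indicator (a ∧ b) ℕ.+ indicator (b ∧ not a)
    split true  true  = refl
    split true  false = refl
    split false true  = refl
    split false false = refl

  symDiff-split : symDiffCount G G' ≡ edgesOnlyIn G G' ℕ.+ edgesOnlyIn G' G
  symDiff-split = pairCount-split (λ i j → split (adj G i j) (adj G' i j))
    where
    split : ∀ a b → indicator (not ⌊ a Bool.≟ b ⌋) ≡ indicator (a ∧ not b) ℕ.+ indicator (b ∧ not a)
    split true  true  = refl
    split true  false = refl
    split false true  = refl
    split false false = refl

  symDiff-sym : symDiffCount G' G ≡ symDiffCount G G'
  symDiff-sym = pairCount-cong (λ i j → ≟-sym (adj G' i j) (adj G i j))
    where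
    ≟-sym : ∀ a b → not ⌊ a Bool.≟ b ⌋ ≡ not ⌊ b Bool.≟ a ⌋
    ≟-sym true  true  = refl
    ≟-sym true  false = refl
    ≟-sym false true  = refl
    ≟-sym false false = refl

  removed≡added : edgeCount G ≡ edgeCount G' → edgesOnlyIn G G' ≡ edgesOnlyIn G' G
  removed≡added m≡m' = +-cancelˡ-≡ _ _ _ (trans (sym edges-split) (trans m≡m' edges-split'))

  differing-pair : ¬ (∀ i j → adj G i j ≡ adj G' i j) → ∃₂ λ i j → toℕ i ℕ.< toℕ j × adj G i j ≢ adj G' i j
  differing-pair G≢G' with ¬∀⟶∃¬ n _ (λ i → all? (λ j → adj G i j Bool.≟ adj G' i j)) G≢G'
  ... | i , ¬∀j with ¬∀⟶∃¬ n _ (λ j → adj G i j Bool.≟ adj G' i j) ¬∀j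
  ...   | j , a≢b with <-cmp (toℕ i) (toℕ j)
  ...     | tri< i<j _ _ = i , j , i<j , a≢b
  ...     | tri> _ _ j<i = j , i , j<i , λ e → a≢b (trans (adj-sym G i j) (trans e (adj-sym G' j i)))
  ...     | tri≈ _ i≡j _ with toℕ-injective i≡j
  ...       | refl = ⊥-elim (a≢b (trans (irrefl G i) (sym (irrefl G' i))))

  symDiff-pos : ¬ (∀ i j → adj G i j ≡ adj G' i j) → 1 ℕ.≤ symDiffCount G G'
  symDiff-pos G≢G' with differing-pair G≢G'
  ... | i , j , i<j , a≢b = drop‿+≤+ (begin
      + 1                                                   ≡⟨ cong +_ (sym (differ (adj G i j) (adj G' i j) a≢b)) ⟩
      + indicator (not ⌊ adj G i j Bool.≟ adj G' i j ⌋)     ≤⟨ pairSum-term (λ i j → +≤+ z≤n) i<j ⟩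
      pairSum (λ i j → + indicator (not ⌊ adj G i j Bool.≟ adj G' i j ⌋))
        ≡⟨ sym (pairCount-pairSum (λ i j → not ⌊ adj G i j Bool.≟ adj G' i j ⌋)) ⟩
      + symDiffCount G G'                                   ∎)
    where
    open ≤-Reasoning
    differ : ∀ a b → a ≢ b → indicator (not ⌊ a Bool.≟ b ⌋) ≡ 1
    differ true  true  a≢b = ⊥-elim (a≢b refl)
    differ true  false _   = refl
    differ false true  _   = refl
    differ false false a≢b = ⊥-elim (a≢b refl)

  removed-pos : ¬ (∀ i j → adj G i j ≡ adj G' i j) → edgeCount G ≡ edgeCount G' → 1 ℕ.≤ edgesOnlyIn G G'
  removed-pos G≢G' m≡m' = half-pos (edgesOnlyIn G G')
    (subst (1 ℕ.≤_) (trans symDiff-split (cong (edgesOnlyIn G G' ℕ.+_) (sym (removed≡added m≡m')))) (symDiff-pos G≢G'))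
    where
    half-pos : ∀ k → 1 ℕ.≤ k ℕ.+ k → 1 ℕ.≤ k
    half-pos (ℕ.suc k) _ = s≤s z≤n

module PartitionComparison {n : ℕ} (G G' : Graph n) (ℓ : Labelling n) where

  open IntegerSums
  open PairSums
  open EdgeDifference G G' using (edgesOnlyIn; removed-pos)
  open GraphSums G using (A; V; V-edge; numerator-pairSum; ∑-V; ∑-V²)
  open GraphSums G' using () renaming (A to A'; V to V'; numerator-pairSum to numerator-pairSum'; ∑-V to ∑-V'; ∑-V² to ∑-V'²)
  open import Data.Bool using (true; false; _∧_; not)
  import Data.Bool as Bool
  import Data.Nat as ℕ
  open import Data.Fin using (_≟_)
  open import Data.Integer using (ℤ; +_; 0ℤ; 1ℤ; _+_; _-_; _*_; -_; _≤_; _<_; +≤+; -<+)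
  open import Data.Integer.Properties
    using (*-zeroˡ; *-zeroʳ; *-identityˡ; *-identityʳ; -1*i≡-i; +-identityˡ; +-identityʳ;
           +-mono-≤; +-monoʳ-≤; +-monoˡ-≤; +-monoʳ-<; neg-mono-≤; neg-involutive; *-monoˡ-≤-nonNeg;
           i≤j⇒0≤j-i; i≤i+j; ≤-trans; ≤-<-trans; ≤-reflexive; module ≤-Reasoning)
  open import Data.Integer.Solver using (module +-*-Solver)
  open import Relation.Binary.PropositionalEquality
  open import Relation.Nullary using (¬_; Dec; yes; no)
  open import Data.Empty using (⊥-elim)
  open import Relation.Nullary.Decidable using (⌊_⌋)

  M : ℤ
  M = + edgeCount G

  T : Fin n → ℤ
  T c = V ℓ c + V' ℓ c

  φ : Fin n → Fin n → ℤ
  φ i j = + 4 * M * δ (ℓ i) (ℓ j) - (T (ℓ i) + T (ℓ j))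

  -- The integer numerator 4m·Σ e(A) − Σ vol(A)² of the modularity of H (for m = edgeCount G).
  numerator : Graph n → ℤ
  numerator H = + 4 * M * + intraEdges H ℓ - + Σ[ (λ c → vol H ℓ c ℕ.* vol H ℓ c) ]

  -- Σ vol² − Σ vol'² = Σ vol·T − Σ vol'·T, since x² − y² = x(x + y) − y(x + y).
  squares-difference : ∑[ c < n ] (V ℓ c * V ℓ c) - ∑[ c < n ] (V' ℓ c * V' ℓ c)
                     ≡ ∑[ c < n ] (V ℓ c * T c) - ∑[ c < n ] (V' ℓ c * T c)
  squares-difference = begin
      ∑[ c < n ] (V ℓ c * V ℓ c) - ∑[ c < n ] (V' ℓ c * V' ℓ c)
    ≡⟨ sym (∑-distrib-- (λ c → V ℓ c * V ℓ c) (λ c → V' ℓ c * V' ℓ c)) ⟩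
      ∑[ c < n ] (V ℓ c * V ℓ c - V' ℓ c * V' ℓ c)
    ≡⟨ sum-cong-≗ (λ c → difference-of-squares (V ℓ c) (V' ℓ c)) ⟩
      ∑[ c < n ] (V ℓ c * T c - V' ℓ c * T c)
    ≡⟨ ∑-distrib-- (λ c → V ℓ c * T c) (λ c → V' ℓ c * T c) ⟩
      ∑[ c < n ] (V ℓ c * T c) - ∑[ c < n ] (V' ℓ c * T c)
    ∎
    where
    open ≡-Reasoning
    open +-*-Solver
    difference-of-squares : ∀ x y → x * x - y * y ≡ x * (x + y) - y * (x + y)
    difference-of-squares = solve 2 (λ x y → x :* x :- y :* y := x :* (x :+ y) :- y :* (x :+ y)) refl

  numerator-difference : numerator G - numerator G' ≡ pairSum (λ i j → (A i j - A' i j) * φ i j)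
  numerator-difference = begin
      (a - S) - (a' - S')
    ≡⟨ regroup a a' S S' ⟩
      (a - a') - (S - S')
    ≡⟨ cong (λ z → (a - a') - z) (trans (cong₂ _-_ (∑-V² ℓ) (∑-V'² ℓ)) squares-difference) ⟩
      (a - a') - (∑[ c < n ] (V ℓ c * T c) - ∑[ c < n ] (V' ℓ c * T c))
    ≡⟨ sym (regroup a a' (∑[ c < n ] (V ℓ c * T c)) (∑[ c < n ] (V' ℓ c * T c))) ⟩
      (a - ∑[ c < n ] (V ℓ c * T c)) - (a' - ∑[ c < n ] (V' ℓ c * T c))
    ≡⟨ cong₂ _-_ (numerator-pairSum ℓ (+ 4 * M) T) (numerator-pairSum' ℓ (+ 4 * M) T) ⟩
      pairSum (λ i j → A i j * φ i j) - pairSum (λ i j → A' i j * φ i j)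
    ≡⟨ sym (pairSum-- (λ i j → A i j * φ i j) (λ i j → A' i j * φ i j)) ⟩
      pairSum (λ i j → A i j * φ i j - A' i j * φ i j)
    ≡⟨ pairSum-cong (λ i j → factor (A i j) (A' i j) (φ i j)) ⟩
      pairSum (λ i j → (A i j - A' i j) * φ i j)
    ∎
    where
    open ≡-Reasoning
    open +-*-Solver
    a a' S S' : ℤ
    a  = + 4 * M * + intraEdges G ℓ
    a' = + 4 * M * + intraEdges G' ℓ
    S  = + Σ[ (λ c → vol G ℓ c ℕ.* vol G ℓ c) ]
    S' = + Σ[ (λ c → vol G' ℓ c ℕ.* vol G' ℓ c) ]
    regroup : ∀ a a' s s' → (a - s) - (a' - s') ≡ (a - a') - (s - s')
    regroup = solve 4 (λ a a' s s' → (a :- s) :- (a' :- s') := (a :- a') :- (s :- s')) refl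
    factor : ∀ x y z → x * z - y * z ≡ (x - y) * z
    factor = solve 3 (λ x y z → x :* z :- y :* z := (x :- y) :* z) refl

  T-nonNeg : ∀ c → 0ℤ ≤ T c
  T-nonNeg c = +≤+ ℕ.z≤n

  ∑-T : edgeCount G ≡ edgeCount G' → ∑[ c < n ] T c ≡ + 4 * M
  ∑-T m≡m' = begin
      ∑[ c < n ] T c                                    ≡⟨ ∑-distrib-+ (V ℓ) (V' ℓ) ⟩
      ∑[ c < n ] V ℓ c + ∑[ c < n ] V' ℓ c
        ≡⟨ cong₂ _+_ (∑-V ℓ) (trans (∑-V' ℓ) (cong (λ m → + 2 * + m) (sym m≡m'))) ⟩
      + 2 * M + + 2 * M                                 ≡⟨ solve 1 (λ m → con (+ 2) :* m :+ con (+ 2) :* m := con (+ 4) :* m) refl M ⟩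
      + 4 * M                                           ∎
    where
    open ≡-Reasoning
    open +-*-Solver

  T≤ : edgeCount G ≡ edgeCount G' → ∀ c → T c ≤ + 4 * M
  T≤ m≡m' c = subst (T c ≤_) (∑-T m≡m') (term≤∑ T-nonNeg c)

  T+T≤ : edgeCount G ≡ edgeCount G' → ∀ {c c'} → c ≢ c' → T c + T c' ≤ + 4 * M
  T+T≤ m≡m' {c} {c'} c≢c' = subst (T c + T c' ≤_) (∑-T m≡m') (two-terms≤∑ T-nonNeg c≢c')

  T-edge : ∀ {i j} → adj G i j ≡ true → ℓ i ≡ ℓ j → + 2 ≤ T (ℓ i)
  T-edge {i} ij∈G ℓi≡ℓj = ≤-trans (V-edge ℓ ij∈G ℓi≡ℓj) (i≤i+j (V ℓ (ℓ i)) (V' ℓ (ℓ i)))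

  φ-same : ∀ {i j} → ℓ i ≡ ℓ j → φ i j ≡ + 4 * M - (T (ℓ i) + T (ℓ i))
  φ-same {i} {j} ℓi≡ℓj with ℓ i ≟ ℓ j
  ... | yes _     = cong₂ _-_ (*-identityʳ (+ 4 * M)) (cong (λ c → T (ℓ i) + T c) (sym ℓi≡ℓj))
  ... | no  ℓi≢ℓj = ⊥-elim (ℓi≢ℓj ℓi≡ℓj)

  φ-apart : ∀ {i j} → ℓ i ≢ ℓ j → φ i j ≡ - (T (ℓ i) + T (ℓ j))
  φ-apart {i} {j} ℓi≢ℓj with ℓ i ≟ ℓ j
  ... | yes ℓi≡ℓj = ⊥-elim (ℓi≢ℓj ℓi≡ℓj)
  ... | no  _     = trans (cong (_- (T (ℓ i) + T (ℓ j))) (*-zeroʳ (+ 4 * M))) (+-identityˡ _)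

  -- An edge of G has coefficient at most 4m − 4: inside a part its endpoints give
  -- that part T ≥ 2, and across parts the coefficient is nonpositive.
  φ-edge≤ : 1ℤ ≤ M → ∀ {i j} → adj G i j ≡ true → φ i j ≤ + 4 * M - + 4
  φ-edge≤ 1≤M {i} {j} ij∈G = by-cases (ℓ i ≟ ℓ j)
    where
    open ≤-Reasoning
    by-cases : Dec (ℓ i ≡ ℓ j) → φ i j ≤ + 4 * M - + 4
    by-cases (yes ℓi≡ℓj) = begin
        φ i j                          ≡⟨ φ-same ℓi≡ℓj ⟩
        + 4 * M - (T (ℓ i) + T (ℓ i))
          ≤⟨ +-monoʳ-≤ (+ 4 * M) (neg-mono-≤ (+-mono-≤ (T-edge ij∈G ℓi≡ℓj) (T-edge ij∈G ℓi≡ℓj))) ⟩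
        + 4 * M - + 4                  ∎
    by-cases (no ℓi≢ℓj) = begin
        φ i j                          ≡⟨ φ-apart ℓi≢ℓj ⟩
        - (T (ℓ i) + T (ℓ j))          ≤⟨ neg-mono-≤ (+≤+ ℕ.z≤n) ⟩
        0ℤ                             ≤⟨ i≤j⇒0≤j-i (*-monoˡ-≤-nonNeg (+ 4) 1≤M) ⟩
        + 4 * M - + 4                  ∎

  φ≥ : edgeCount G ≡ edgeCount G' → ∀ i j → - φ i j ≤ + 4 * M
  φ≥ m≡m' i j = by-cases (ℓ i ≟ ℓ j)
    where
    open ≤-Reasoning
    open +-*-Solver
    by-cases : Dec (ℓ i ≡ ℓ j) → - φ i j ≤ + 4 * M
    by-cases (yes ℓi≡ℓj) = begin
        - φ i j                              ≡⟨ cong -_ (φ-same ℓi≡ℓj) ⟩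
        - (+ 4 * M - (T (ℓ i) + T (ℓ i)))    ≡⟨ solve 2 (λ a t → :- (a :- (t :+ t)) := (t :+ t) :- a) refl (+ 4 * M) (T (ℓ i)) ⟩
        (T (ℓ i) + T (ℓ i)) - + 4 * M        ≤⟨ +-monoˡ-≤ (- (+ 4 * M)) (+-mono-≤ (T≤ m≡m' (ℓ i)) (T≤ m≡m' (ℓ i))) ⟩
        (+ 4 * M + + 4 * M) - + 4 * M        ≡⟨ solve 1 (λ a → (a :+ a) :- a := a) refl (+ 4 * M) ⟩
        + 4 * M                              ∎
    by-cases (no ℓi≢ℓj) = begin
        - φ i j                              ≡⟨ cong -_ (φ-apart ℓi≢ℓj) ⟩
        - - (T (ℓ i) + T (ℓ j))              ≡⟨ neg-involutive _ ⟩
        T (ℓ i) + T (ℓ j)                    ≤⟨ T+T≤ m≡m' ℓi≢ℓj ⟩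
        + 4 * M                              ∎

  Δ R : Fin n → Fin n → ℤ
  Δ i j = + indicator (not ⌊ adj G i j Bool.≟ adj G' i j ⌋)
  R i j = + indicator (adj G i j ∧ not (adj G' i j))

  -- Pointwise comparison: pairs outside E △ E' contribute nothing, a pair of E ∖ E'
  -- contributes φ ≤ 4m − 4, and a pair of E' ∖ E contributes −φ ≤ 4m.
  pair-bound : 1ℤ ≤ M → edgeCount G ≡ edgeCount G' →
               ∀ i j → (A i j - A' i j) * φ i j ≤ + 4 * M * Δ i j - + 4 * R i j
  pair-bound 1≤M m≡m' i j with adj G i j in ij∈G | adj G' i j
  ... | true  | true  = ≤-reflexive (trans (*-zeroˡ (φ i j)) (sym (cong (_- 0ℤ) (*-zeroʳ (+ 4 * M)))))
  ... | false | false = ≤-reflexive (trans (*-zeroˡ (φ i j)) (sym (cong (_- 0ℤ) (*-zeroʳ (+ 4 * M)))))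
  ... | true  | false = begin
      (1ℤ - 0ℤ) * φ i j                ≡⟨ *-identityˡ (φ i j) ⟩
      φ i j                            ≤⟨ φ-edge≤ 1≤M ij∈G ⟩
      + 4 * M - + 4                    ≡⟨ cong (_- + 4) (sym (*-identityʳ (+ 4 * M))) ⟩
      + 4 * M * 1ℤ - + 4 * 1ℤ          ∎
    where open ≤-Reasoning
  ... | false | true  = begin
      (0ℤ - 1ℤ) * φ i j                ≡⟨ -1*i≡-i (φ i j) ⟩
      - φ i j                          ≤⟨ φ≥ m≡m' i j ⟩
      + 4 * M                          ≡⟨ sym (trans (cong (_- + 4 * 0ℤ) (*-identityʳ (+ 4 * M))) (+-identityʳ (+ 4 * M))) ⟩
      + 4 * M * 1ℤ - + 4 * 0ℤ          ∎
    where open ≤-Reasoning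

  numerator-bound : 1ℤ ≤ M → edgeCount G ≡ edgeCount G' →
    numerator G - numerator G' ≤ + 4 * M * + symDiffCount G G' - + 4 * + edgesOnlyIn G G'
  numerator-bound 1≤M m≡m' = begin
      numerator G - numerator G'
    ≡⟨ numerator-difference ⟩
      pairSum (λ i j → (A i j - A' i j) * φ i j)
    ≤⟨ pairSum-mono (pair-bound 1≤M m≡m') ⟩
      pairSum (λ i j → + 4 * M * Δ i j - + 4 * R i j)
    ≡⟨ pairSum-- (λ i j → + 4 * M * Δ i j) (λ i j → + 4 * R i j) ⟩
      pairSum (λ i j → + 4 * M * Δ i j) - pairSum (λ i j → + 4 * R i j)
    ≡⟨ cong₂ _-_ (pairSum-scale (+ 4 * M) Δ) (pairSum-scale (+ 4) R) ⟩
      + 4 * M * pairSum Δ - + 4 * pairSum R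
    ≡⟨ sym (cong₂ (λ x y → + 4 * M * x - + 4 * y)
             (pairCount-pairSum (λ i j → not ⌊ adj G i j Bool.≟ adj G' i j ⌋))
             (pairCount-pairSum (λ i j → adj G i j ∧ not (adj G' i j)))) ⟩
      + 4 * M * + symDiffCount G G' - + 4 * + edgesOnlyIn G G'
    ∎
    where open ≤-Reasoning

  -- Since G ≠ G' forces |E ∖ E'| ≥ 1, the inequality is strict.
  numerator-strict : ¬ (∀ i j → adj G i j ≡ adj G' i j) → edgeCount G ≡ edgeCount G' → 1 ℕ.≤ edgeCount G →
    numerator G - numerator G' < + 4 * M * + symDiffCount G G'
  numerator-strict G≢G' m≡m' 1≤m = ≤-<-trans (numerator-bound (+≤+ 1≤m) m≡m')
    (drop-positive (+ 4 * M * + symDiffCount G G') (removed-pos G≢G' m≡m'))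
    where
    drop-positive : ∀ x {k} → 1 ℕ.≤ k → x - + 4 * + k < x
    drop-positive x {ℕ.suc k} _ = subst (x - + 4 * + ℕ.suc k <_) (+-identityʳ x) (+-monoʳ-< x -<+)

module ClearingDenominators where

  open import Data.Nat as ℕ using (suc)
  open import Data.Integer as ℤ using (ℤ; +_)
  import Data.Integer.Properties as ℤP
  open import Data.Integer.Solver using (module +-*-Solver)
  open import Data.Rational as ℚ using (ℚ; toℚᵘ)
  import Data.Rational.Properties as ℚP
  open import Data.Rational.Unnormalised as ℚᵘ using (mkℚᵘ; *<*; _≃_)
  import Data.Rational.Unnormalised.Properties as ℚᵘP
  open import Relation.Binary.PropositionalEquality

  -- The inequality between the two modularities, with the denominators m = suc m₀ and
  -- K = suc k₀ = 4m² cleared, becomes the integer inequality of numerator-strict.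
  fraction-gap : ∀ m₀ k₀ (e s e' s' d : ℤ) → + suc k₀ ≡ + 4 ℤ.* + suc m₀ ℤ.* + suc m₀ →
    (+ 4 ℤ.* + suc m₀ ℤ.* e ℤ.- s) ℤ.- (+ 4 ℤ.* + suc m₀ ℤ.* e' ℤ.- s') ℤ.< + 4 ℤ.* + suc m₀ ℤ.* d →
    mkℚᵘ e m₀ ℚᵘ.- mkℚᵘ s k₀ ℚᵘ.< (mkℚᵘ e' m₀ ℚᵘ.- mkℚᵘ s' k₀) ℚᵘ.+ mkℚᵘ d m₀
  fraction-gap m₀ k₀ e s e' s' d K≡4m² gap = *<* (subst₂ ℤ._<_ (ℤP.*-comm P a) (scaled-rhs b d) (ℤP.*-monoˡ-<-pos P over-K))
    where
    open +-*-Solver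
    m K P a b : ℤ
    m = + suc m₀
    K = + suc k₀
    P = m ℤ.* K ℤ.* m
    a = e ℤ.* K ℤ.+ ℤ.- s ℤ.* m
    b = e' ℤ.* K ℤ.+ ℤ.- s' ℤ.* m
    -- Multiplying 4m·e − s by m gives the numerator e·K − s·m of e/m − s/K.
    times-m : ∀ e s → m ℤ.* (+ 4 ℤ.* m ℤ.* e ℤ.- s) ≡ e ℤ.* K ℤ.+ ℤ.- s ℤ.* m
    times-m e s = trans (solve 3 (λ m e s → m :* (con (+ 4) :* m :* e :- s) := e :* (con (+ 4) :* m :* m) :+ (:- s) :* m) refl m e s)
                        (cong (λ k → e ℤ.* k ℤ.+ ℤ.- s ℤ.* m) (sym K≡4m²))
    over-K : a ℤ.< b ℤ.+ d ℤ.* K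
    over-K = subst₂ ℤ._<_ (times-m e s) rhs (ℤP.*-monoˡ-<-pos m moved)
      where
      moved : + 4 ℤ.* m ℤ.* e ℤ.- s ℤ.< (+ 4 ℤ.* m ℤ.* e' ℤ.- s') ℤ.+ + 4 ℤ.* m ℤ.* d
      moved = subst₂ ℤ._<_ (solve 2 (λ x y → x :- y :+ y := x) refl (+ 4 ℤ.* m ℤ.* e ℤ.- s) (+ 4 ℤ.* m ℤ.* e' ℤ.- s'))
                           (ℤP.+-comm (+ 4 ℤ.* m ℤ.* d) _) (ℤP.+-monoˡ-< (+ 4 ℤ.* m ℤ.* e' ℤ.- s') gap)
      rhs : m ℤ.* ((+ 4 ℤ.* m ℤ.* e' ℤ.- s') ℤ.+ + 4 ℤ.* m ℤ.* d) ≡ b ℤ.+ d ℤ.* K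
      rhs = trans (ℤP.*-distribˡ-+ m (+ 4 ℤ.* m ℤ.* e' ℤ.- s') (+ 4 ℤ.* m ℤ.* d)) (cong₂ ℤ._+_ (times-m e' s')
              (trans (solve 2 (λ m d → m :* (con (+ 4) :* m :* d) := d :* (con (+ 4) :* m :* m)) refl m d) (cong (d ℤ.*_) (sym K≡4m²))))
    scaled-rhs : ∀ b d → P ℤ.* (b ℤ.+ d ℤ.* K) ≡ (b ℤ.* m ℤ.+ d ℤ.* (m ℤ.* K)) ℤ.* (m ℤ.* K)
    scaled-rhs = solve 4 (λ m k b d → (m :* k :* m) :* (b :+ d :* k) := (b :* m :+ d :* (m :* k)) :* (m :* k)) refl m K

  /ℕ-toℚᵘ : ∀ a b → toℚᵘ (a /ℕ suc b) ≃ mkℚᵘ (+ a) b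
  /ℕ-toℚᵘ a b = ℚP.toℚᵘ-fromℚᵘ (mkℚᵘ (+ a) b)

  toℚᵘ-homo-- : ∀ p q → toℚᵘ (p ℚ.- q) ≃ toℚᵘ p ℚᵘ.- toℚᵘ q
  toℚᵘ-homo-- p q = ℚᵘP.≃-trans (ℚP.toℚᵘ-homo-+ p (ℚ.- q)) (ℚᵘP.+-congʳ (toℚᵘ p) (ℚP.toℚᵘ-homo‿- q))

  modularity-gap : ∀ m₀ (e s e' s' d : ℕ) →
    (+ 4 ℤ.* + suc m₀ ℤ.* + e ℤ.- + s) ℤ.- (+ 4 ℤ.* + suc m₀ ℤ.* + e' ℤ.- + s') ℤ.< + 4 ℤ.* + suc m₀ ℤ.* + d →
    (e /ℕ suc m₀) ℚ.- (s /ℕ (4 ℕ.* suc m₀ ℕ.* suc m₀))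
      ℚ.< ((e' /ℕ suc m₀) ℚ.- (s' /ℕ (4 ℕ.* suc m₀ ℕ.* suc m₀))) ℚ.+ (d /ℕ suc m₀)
  modularity-gap m₀ e s e' s' d gap =
    ℚP.toℚᵘ-cancel-< (ℚᵘP.<-respʳ-≃ (ℚᵘP.≃-sym rhs) (ℚᵘP.<-respˡ-≃ (ℚᵘP.≃-sym lhs)
      (fraction-gap m₀ k₀ (+ e) (+ s) (+ e') (+ s') (+ d) K≡4m² gap)))
    where
    k₀ : ℕ
    k₀ = ℕ.pred (4 ℕ.* suc m₀ ℕ.* suc m₀)
    K≡4m² : + suc k₀ ≡ + 4 ℤ.* + suc m₀ ℤ.* + suc m₀
    K≡4m² = trans (ℤP.pos-* (4 ℕ.* suc m₀) (suc m₀)) (cong (ℤ._* + suc m₀) (ℤP.pos-* 4 (suc m₀)))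
    difference : ∀ x y → toℚᵘ ((x /ℕ suc m₀) ℚ.- (y /ℕ suc k₀)) ≃ mkℚᵘ (+ x) m₀ ℚᵘ.- mkℚᵘ (+ y) k₀
    difference x y = ℚᵘP.≃-trans (toℚᵘ-homo-- (x /ℕ suc m₀) (y /ℕ suc k₀))
                                 (ℚᵘP.+-cong (/ℕ-toℚᵘ x m₀) (ℚᵘP.-‿cong (/ℕ-toℚᵘ y k₀)))
    lhs : toℚᵘ ((e /ℕ suc m₀) ℚ.- (s /ℕ suc k₀)) ≃ mkℚᵘ (+ e) m₀ ℚᵘ.- mkℚᵘ (+ s) k₀
    lhs = difference e s
    rhs : toℚᵘ (((e' /ℕ suc m₀) ℚ.- (s' /ℕ suc k₀)) ℚ.+ (d /ℕ suc m₀))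
        ≃ (mkℚᵘ (+ e') m₀ ℚᵘ.- mkℚᵘ (+ s') k₀) ℚᵘ.+ mkℚᵘ (+ d) m₀
    rhs = ℚᵘP.≃-trans (ℚP.toℚᵘ-homo-+ ((e' /ℕ suc m₀) ℚ.- (s' /ℕ suc k₀)) (d /ℕ suc m₀))
                      (ℚᵘP.+-cong (difference e' s') (/ℕ-toℚᵘ d m₀))

  /ℕ-pos : ∀ {a b} → 1 ℕ.≤ a → 1 ℕ.≤ b → ℚ.0ℚ ℚ.< (a /ℕ b)
  /ℕ-pos {suc a} {suc b} _ _ = ℚP.toℚᵘ-cancel-< (ℚᵘP.<-respʳ-≃ (ℚᵘP.≃-sym (/ℕ-toℚᵘ (suc a) b)) (*<* (ℤ.+<+ ℕ.z<s)))

module Maxima where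

  open import Data.List using ([]; _∷_; map)
  open import Data.Rational using (ℚ; 0ℚ; _+_; _-_; -_; _<_; _⊔_; ∣_∣)
  open import Data.Rational.Properties
    using (⊔-sel; p≤p⊔q; p≤q⊔p; <-≤-trans; +-monoˡ-≤; +-monoˡ-<; +-identityˡ; ∣p∣≡p∨∣p∣≡-p)
  open import Data.Rational.Solver using (module +-*-Solver)
  open import Data.Sum using (inj₁; inj₂)
  open import Relation.Binary.PropositionalEquality

  ⊔-<-lub : ∀ {x y z} → x < z → y < z → x ⊔ y < z
  ⊔-<-lub {x} {y} {z} x<z y<z with ⊔-sel x y
  ... | inj₁ x⊔y≡x = subst (_< z) (sym x⊔y≡x) x<z
  ... | inj₂ x⊔y≡y = subst (_< z) (sym x⊔y≡y) y<z

  -- If f lies below g + r pointwise, then max f lies below max g + r.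
  -- (The empty list has maximum 0 by convention, hence 0 < r.)
  maxList-shift : ∀ {X : Set} (f g : X → ℚ) {r : ℚ} → 0ℚ < r → (∀ x → f x < g x + r) →
                  ∀ xs → maxList (map f xs) < maxList (map g xs) + r
  maxList-shift f g {r} 0<r f<g+r []           = subst (0ℚ <_) (sym (+-identityˡ r)) 0<r
  maxList-shift f g     0<r f<g+r (x ∷ [])     = f<g+r x
  maxList-shift f g {r} 0<r f<g+r (x ∷ y ∷ ys) = ⊔-<-lub
    (<-≤-trans (f<g+r x) (+-monoˡ-≤ r (p≤p⊔q (g x) (maxList (map g (y ∷ ys))))))
    (<-≤-trans (maxList-shift f g 0<r f<g+r (y ∷ ys)) (+-monoˡ-≤ r (p≤q⊔p (g x) (maxList (map g (y ∷ ys))))))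

  difference< : ∀ {a b r} → a < b + r → a - b < r
  difference< {a} {b} {r} a<b+r = subst (a - b <_) (solve 2 (λ b r → (b :+ r) :- b := r) refl b r) (+-monoˡ-< (- b) a<b+r)
    where open +-*-Solver

  negate-difference : ∀ x y → - (x - y) ≡ y - x
  negate-difference = solve 2 (λ x y → :- (x :- y) := y :- x) refl
    where open +-*-Solver

  ∣-∣<-from-bounds : ∀ {x y r} → x < y + r → y < x + r → ∣ x - y ∣ < r
  ∣-∣<-from-bounds {x} {y} {r} x<y+r y<x+r with ∣p∣≡p∨∣p∣≡-p (x - y)
  ... | inj₁ ∣x-y∣≡x-y    = subst (_< r) (sym ∣x-y∣≡x-y) (difference< x<y+r)
  ... | inj₂ ∣x-y∣≡-[x-y] = subst (_< r) (sym (trans ∣x-y∣≡-[x-y] (negate-difference x y))) (difference< y<x+r)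

module PerPartition where

  open PartitionComparison using (numerator-strict)
  open ClearingDenominators using (modularity-gap)
  open import Data.Nat as ℕ using (suc; s≤s)
  open import Data.Integer as ℤ using (+_)
  open import Data.Product using (Σ-syntax; _,_)
  open import Data.Rational using (_+_; _-_; _<_)
  open import Relation.Binary.PropositionalEquality
  open import Relation.Nullary using (¬_)

  -- A positive edge count is a successor, so the denominators of modularity are suc-forms.
  as-successor : ∀ {m} → 1 ℕ.≤ m → Σ[ m₀ ∈ ℕ ] m ≡ suc m₀
  as-successor (s≤s _) = _ , refl

  modularity-at : ∀ {n} (H : Graph n) (ℓ : Labelling n) {m₀} → edgeCount H ≡ suc m₀ →
    modularity H ℓ ≡ (intraEdges H ℓ /ℕ suc m₀) - (Σ[ (λ c → vol H ℓ c ℕ.* vol H ℓ c) ] /ℕ (4 ℕ.* suc m₀ ℕ.* suc m₀))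
  modularity-at H ℓ = cong (λ m → (intraEdges H ℓ /ℕ m) - (Σ[ (λ c → vol H ℓ c ℕ.* vol H ℓ c) ] /ℕ (4 ℕ.* m ℕ.* m)))

  modularity-shift : ∀ {n} (G G' : Graph n) → ¬ (∀ i j → adj G i j ≡ adj G' i j) →
    edgeCount G ≡ edgeCount G' → 1 ℕ.≤ edgeCount G →
    ∀ ℓ → modularity G ℓ < modularity G' ℓ + (symDiffCount G G' /ℕ edgeCount G)
  modularity-shift G G' G≢G' m≡m' 1≤m ℓ with as-successor 1≤m
  ... | m₀ , m≡1+m₀ = subst₂ _<_ (sym (modularity-at G ℓ m≡1+m₀))
        (sym (cong₂ _+_ (modularity-at G' ℓ (trans (sym m≡m') m≡1+m₀)) (cong (symDiffCount G G' /ℕ_) m≡1+m₀)))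
        (modularity-gap m₀ (intraEdges G ℓ) (squares G) (intraEdges G' ℓ) (squares G') (symDiffCount G G') (subst
          (λ m → (+ 4 ℤ.* + m ℤ.* + intraEdges G ℓ ℤ.- + squares G) ℤ.- (+ 4 ℤ.* + m ℤ.* + intraEdges G' ℓ ℤ.- + squares G')
             ℤ.< + 4 ℤ.* + m ℤ.* + symDiffCount G G')
          m≡1+m₀ (numerator-strict G G' ℓ G≢G' m≡m' 1≤m)))
    where
    squares : Graph _ → ℕ
    squares H = Σ[ (λ c → vol H ℓ c ℕ.* vol H ℓ c) ]

open import Data.Nat using (_≤_)
open import Data.Rational using (ℚ; 0ℚ; _+_; _-_; _<_; ∣_∣)
open import Relation.Nullary using (¬_)
open import Relation.Binary.PropositionalEquality using (_≡_; sym; subst; subst₂)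
open PerPartition using (modularity-shift)
open Maxima using (maxList-shift; ∣-∣<-from-bounds)
open ClearingDenominators using (/ℕ-pos)

-- Every partition moves by less than |E △ E'| / m in
-- each direction, hence so does the maximum over all partitions.
lemma5p2 : (n : ℕ) (G G' : Graph n) →
    ¬ (∀ i j → adj G i j ≡ adj G' i j) →
    edgeCount G ≡ edgeCount G' →
    1 ≤ edgeCount G →
    ∣ maxModularity G - maxModularity G' ∣ < (symDiffCount G G' /ℕ edgeCount G)
lemma5p2 n G G' G≢G' m≡m' 1≤m =
  ∣-∣<-from-bounds (maxList-shift (modularity G) (modularity G') 0<r G-below (allFuns n n))
                   (maxList-shift (modularity G') (modularity G) 0<r G'-below (allFuns n n))
  where
  open EdgeDifference G G' using (symDiff-pos; symDiff-sym)
  r : ℚ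
  r = symDiffCount G G' /ℕ edgeCount G
  0<r : 0ℚ < r
  0<r = /ℕ-pos (symDiff-pos G≢G') 1≤m
  G-below : ∀ ℓ → modularity G ℓ < modularity G' ℓ + r
  G-below = modularity-shift G G' G≢G' m≡m' 1≤m
  G'-below : ∀ ℓ → modularity G' ℓ < modularity G ℓ + r
  G'-below ℓ = subst₂ (λ d m → modularity G' ℓ < modularity G ℓ + (d /ℕ m)) symDiff-sym (sym m≡m')
    (modularity-shift G' G (λ G'≡G → G≢G' (λ i j → sym (G'≡G i j))) (sym m≡m') (subst (1 ≤_) m≡m' 1≤m) ℓ)
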